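{- Let $\Gamma$ and $\Delta$ be directed graphs, let $\mathbf{P}=P\Delta$ be the free category on $\Delta$, let $RelB$ be a set of pairs $(l,r)$ of parallel arrows of $\mathbf{P}$ (i.e. $l,r:B\to B'$ for some objects $B,B'$), and let $\mathbf{B}=\mathbf{P}/RelB$ be the quotient category (by the congruence generated by $RelB$), with $[p]$ denoting the class of an arrow $p$. Let $X$ assign to each object $A$ of $\Gamma$ a set $XA$ and to each arrow $a:A_1\to A_2$ of $\Gamma$ a function $XA_1\to XA_2$, $x\mapsto x\cdot a$; and let $F$ be a graph morphism from $\Gamma$ to the underlying graph of $\mathbf{P}$ (assigning an object $FA$ of $\Delta$ to each object $A$ and an arrow $F(a):FA_1\to FA_2$ of $\mathbf{P}$ to each arrow $a:A_1\to A_2$). Let $\mathbf{A}$ be a small category generated by the graph $\Gamma$, let $X'$ be an action of $\mathbf{A}$ with $X'A=XA$ for every object $A$ and $X'a=Xa$ for every arrow $a$ of $\Gamma$, and let $F':\mathbf{A}\to\mathbf{B}$ be a functor with $F'A=FA$ for every object and $F'(a)=[F(a)]$ for every arrow $a$ of $\Gamma$. Let $T=\bigsqcup_{B\in\mathrm{ob}\,\Delta}\bigsqcup_{A\in\mathrm{ob}\,\Gamma} XA\times\mathbf{P}(FA,B)$, with elements written $x|p$, with $\tau(x|p)=\mathrm{tgt}(p)$ and with partial right action $(x|p)\cdot q=x|pq$ whenever $\mathrm{src}(q)=\tau(x|p)$. Let $R=(R_\varepsilon,R_K)$ where $R_\varepsilon=\{(x|F(a),\ (x\cdot a)|\mathrm{id}_{FA_2})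 : a:A_1\to A_2 \text{ an arrow of }\Gamma,\ x\in XA_1\}$ and $R_K=RelB$, and let $\stackrel{*}{\leftrightarrow}_R$ be the reflexive, symmetric, transitive closure of the reduction relation $\to_R$ generated by $R$ on $T$; write $[t]$ for the class of $t\in T$. Then: (i) $t_1\stackrel{*}{\leftrightarrow}_R t_2$ implies $\tau(t_1)=\tau(t_2)$, so $\bar\tau[t]:=\tau(t)$ is well defined; (ii) for each object $B$ of $\mathbf{B}$ put $KB=\{[t]: \bar\tau[t]=B\}$, and for each arrow $b:B_1\to B_2$ of $\mathbf{B}$ put $Kb:KB_1\to KB_2$, $[t]\mapsto[t\cdot p]$ where $p$ is any arrow of $\mathbf{P}$ with $[p]=b$; this is well defined and makes $K$ an action of $\mathbf{B}$; (iii) with $\varepsilon_A:XA\to K(F'A)$, $x\mapsto [x|\mathrm{id}_{FA}]$ for each object $A$ of $\mathbf{A}$, the pair $(K,\varepsilon)$ is a Kan extension of the action $X'$ along $F'$.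
   Context: Free category: $P\Delta$ has the objects of $\Delta$, an identity $\mathrm{id}_B$ at each object, and as non-identity arrows $B\to B'$ the nonempty composable words $d_1\cdots d_n$ of arrows of $\Delta$ with $\mathrm{tgt}(d_i)=\mathrm{src}(d_{i+1})$, $\mathrm{src}(d_1)=B$, $\mathrm{tgt}(d_n)=B'$; composition is juxtaposition, and $pq$ means "first $p$, then $q$" (diagrammatic order throughout). An action of a category $\mathbf{C}$ assigns a set $KC$ to each object $C$ and to each arrow $c:C_1\to C_2$ a function $Kc:KC_1\to KC_2$, written $z\mapsto z\cdot c$, such that $z\cdot\mathrm{id}=z$ and $(z\cdot c_1)\cdot c_2=z\cdot(c_1c_2)$. The reduction relation $\to_R$ generated by $R=(R_T,R_P)$ (with $R_T\subseteq T\times T$, $R_P$ a set of pairs of parallel arrows of $\mathbf{P}$) is: $t_1\to_R t_2$ iff either there are $(s,u)\in R_T$ and an arrow $q$ with $t_1=s\cdot q$, $t_2=u\cdot q$, or there are $(l,r)\in R_P$, $s\in T$ and an arrow $q$ (identities allowed) with $t_1=s\cdot(lq)$, $t_2=s\cdot(rq)$. Given an action $X'$ of $\mathbf{A}$ and a functor $F':\mathbf{A}\to\mathbf{B}$, an extension of $X'$ along $F'$ is a pair $(K,\varepsilon)$ with $K$ an action of $\mathbf{B}$ and $\varepsilon$ a family of functions $\varepsilon_A:X'A\to K(F'A)$ natural in the sense $\varepsilon_{A_2}(x\cdot a)=\varepsilon_{A_1}(x)\cdot F'(a)$ for all $a:A_1\to A_2$. It is a Kan extension if for every extension $(K',\varepsilon')$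 there is a unique natural transformation $\alpha:K\to K'$ (functions $\alpha_B:KB\to K'B$ with $\alpha_{B_2}(z\cdot b)=\alpha_{B_1}(z)\cdot b$) such that $\varepsilon'_A=\alpha_{F'A}\circ\varepsilon_A$ for all $A$. -}

module Defs where

open import Level using (Level; _⊔_; 0ℓ) renaming (suc to lsuc)
open import Data.Product using (Σ; ∃; _×_; _,_; proj₁; proj₂)
open import Relation.Binary using (Setoid; Rel; IsEquivalence)
open import Relation.Binary.PropositionalEquality as ≡ using (_≡_)
open import Relation.Binary.Construct.Closure.ReflexiveTransitive
  using (Star; ε; _◅_; _◅◅_)
open import Relation.Binary.Construct.Closure.ReflexiveTransitive.Properties
  using (◅◅-assoc)
open import Relation.Binary.Construct.Closure.Equivalence
  using (EqClosure) renaming (isEquivalence to eqc-isEquivalence)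

record Graph : Set₁ where
  field
    V : Set
    E : V → V → Set
open Graph public

-- Arrows of the free category P G: words of composable edges, in
-- diagrammatic order (d₁ ◅ d₂ ◅ … means "first d₁, then d₂").
Path : (G : Graph) → V G → V G → Set
Path G = Star (E G)

◅◅-rightId : ∀ {G : Graph} {a b} (p : Path G a b) → (p ◅◅ ε) ≡ p
◅◅-rightId ε = ≡.refl
◅◅-rightId (x ◅ p) = ≡.cong (x ◅_) (◅◅-rightId p)

-- Small categories with a given object set; hom-sets carry an equality
-- (needed because quotient categories are represented by setoids).
-- Composition _⨾_ is diagrammatic: f ⨾ g = "first f, then g".

record Category (Obj : Set) : Set₁ where
  infixr 9 _⨾_
  infix 4 _≈_
  field
    Hom    : Obj → Obj → Set
    _≈_    : ∀ {a b} → Rel (Hom a b) 0ℓ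
    ≈-equiv : ∀ {a b} → IsEquivalence (_≈_ {a} {b})
    id     : ∀ {a} → Hom a a
    _⨾_    : ∀ {a b c} → Hom a b → Hom b c → Hom a c
    ⨾-cong : ∀ {a b c} {f f' : Hom a b} {g g' : Hom b c} →
             f ≈ f' → g ≈ g' → (f ⨾ g) ≈ (f' ⨾ g')
    idˡ    : ∀ {a b} (f : Hom a b) → (id ⨾ f) ≈ f
    idʳ    : ∀ {a b} (f : Hom a b) → (f ⨾ id) ≈ f
    assoc  : ∀ {a b c d} (f : Hom a b) (g : Hom b c) (h : Hom c d) →
             ((f ⨾ g) ⨾ h) ≈ (f ⨾ (g ⨾ h))



record Functor {O₁ O₂ : Set} (C : Category O₁) (D : Category O₂)
               (F₀ : O₁ → O₂) : Set where
  private
    module C = Category C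
    module D = Category D
  field
    F₁     : ∀ {a b} → C.Hom a b → D.Hom (F₀ a) (F₀ b)
    F-cong : ∀ {a b} {f g : C.Hom a b} → f C.≈ g → F₁ f D.≈ F₁ g
    F-id   : ∀ {a} → F₁ (C.id {a}) D.≈ D.id
    F-comp : ∀ {a b c} (f : C.Hom a b) (g : C.Hom b c) →
             F₁ (f C.⨾ g) D.≈ (F₁ f D.⨾ F₁ g)
open Functor public using (F₁)

module _ {Γ : Graph} (C : Category (V Γ)) where
  open Category C
  interp : (gen : ∀ {a b} → E Γ a b → Hom a b) →
           ∀ {a b} → Path Γ a b → Hom a b
  interp gen ε = id
  interp gen (e ◅ w) = gen e ⨾ interp gen w

  GeneratedBy : (gen : ∀ {a b} → E Γ a b → Hom a b) → Set
  GeneratedBy gen = ∀ {a b} (f : Hom a b) → ∃ λ (w : Path Γ a b) → f ≈ interp gen w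

module _ (Δ : Graph) (RelB : ∀ {B B'} → Rel (Path Δ B B') 0ℓ) where

  data _∼_ : ∀ {B B'} → Rel (Path Δ B B') 0ℓ where
    ∼-base  : ∀ {B B'} {l r : Path Δ B B'} → RelB l r → l ∼ r
    ∼-refl  : ∀ {B B'} {p : Path Δ B B'} → p ∼ p
    ∼-sym   : ∀ {B B'} {p q : Path Δ B B'} → p ∼ q → q ∼ p
    ∼-trans : ∀ {B B'} {p q s : Path Δ B B'} → p ∼ q → q ∼ s → p ∼ s
    ∼-comp  : ∀ {B B' B''} {p p' : Path Δ B B'} {q q' : Path Δ B' B''} →
              p ∼ p' → q ∼ q' → (p ◅◅ q) ∼ (p' ◅◅ q')

  QuotCat : Category (V Δ)
  QuotCat = record
    { Hom = Path Δ
    ; _≈_ = _∼_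
    ; ≈-equiv = record { refl = ∼-refl ; sym = ∼-sym ; trans = ∼-trans }
    ; id = ε
    ; _⨾_ = _◅◅_
    ; ⨾-cong = ∼-comp
    ; idˡ = λ f → ∼-refl
    ; idʳ = λ f → ≡.subst (λ z → z ∼ f) (≡.sym (◅◅-rightId f)) ∼-refl
    ; assoc = λ f g h → ≡.subst (λ z → ((f ◅◅ g) ◅◅ h) ∼ z)
                          (◅◅-assoc f g h) ∼-refl
    }

-- Actions of a category (setoid-valued: a set is a setoid, quotient
-- sets are setoids with the quotienting equivalence).

module _ {O : Set} (C : Category O) where
  private module C = Category C

  record IsAction {c ℓ} (S : O → Setoid c ℓ)
      (act : ∀ {a b} → Setoid.Carrier (S a) → C.Hom a b → Setoid.Carrier (S b))
      : Set (c ⊔ ℓ) where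
    private module S (a : O) = Setoid (S a)
    field
      act-cong : ∀ {a b} {x y : S.Carrier a} {f g : C.Hom a b} →
                 S._≈_ a x y → f C.≈ g → S._≈_ b (act x f) (act y g)
      act-id   : ∀ {a} (x : S.Carrier a) → S._≈_ a (act x C.id) x
      act-comp : ∀ {a b c} (x : S.Carrier a) (f : C.Hom a b) (g : C.Hom b c) →
                 S._≈_ c (act (act x f) g) (act x (f C.⨾ g))

  record Action (c ℓ : Level) : Set (lsuc (c ⊔ ℓ)) where
    field
      S        : O → Setoid c ℓ
      act      : ∀ {a b} → Setoid.Carrier (S a) → C.Hom a b → Setoid.Carrier (S b)
      isAction : IsAction S act

  record NatTrans {c ℓ c' ℓ'} (K : Action c ℓ) (K' : Action c' ℓ')
      : Set (c ⊔ ℓ ⊔ c' ⊔ ℓ') where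
    private
      module K = Action K
      module K' = Action K'
    field
      α     : ∀ b → Setoid.Carrier (K.S b) → Setoid.Carrier (K'.S b)
      α-cong : ∀ {b} {z z' : Setoid.Carrier (K.S b)} →
               Setoid._≈_ (K.S b) z z' → Setoid._≈_ (K'.S b) (α b z) (α b z')
      α-nat : ∀ {b₁ b₂} (z : Setoid.Carrier (K.S b₁)) (f : C.Hom b₁ b₂) →
              Setoid._≈_ (K'.S b₂) (α b₂ (K.act z f)) (K'.act (α b₁ z) f)
  open NatTrans public

mkAction : ∀ {O : Set} (C : Category O) {c ℓ} (S : O → Setoid c ℓ)
  (act : ∀ {a b} → Setoid.Carrier (S a) → Category.Hom C a b → Setoid.Carrier (S b)) →
  IsAction C S act → Action C c ℓ
mkAction C S act isA = record { S = S ; act = act ; isAction = isA }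

module _ {OA OB : Set} {A : Category OA} {B : Category OB}
         (X' : Action A 0ℓ 0ℓ) {F₀ : OA → OB} (F' : Functor A B F₀) where
  private
    module X' = Action X'

  record IsExtension (K : Action B 0ℓ 0ℓ)
      (eps : ∀ a → Setoid.Carrier (X'.S a) → Setoid.Carrier (Action.S K (F₀ a)))
      : Set where
    field
      eps-cong : ∀ {a} {x y : Setoid.Carrier (X'.S a)} →
                 Setoid._≈_ (X'.S a) x y →
                 Setoid._≈_ (Action.S K (F₀ a)) (eps a x) (eps a y)
      eps-nat  : ∀ {a₁ a₂} (f : Category.Hom A a₁ a₂) (x : Setoid.Carrier (X'.S a₁)) →
                 Setoid._≈_ (Action.S K (F₀ a₂)) (eps a₂ (X'.act x f))
                   (Action.act K (eps a₁ x) (F₁ F' f))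

  IsKanExtension : (K : Action B 0ℓ 0ℓ) →
    (eps : ∀ a → Setoid.Carrier (X'.S a) → Setoid.Carrier (Action.S K (F₀ a))) → Set₁
  IsKanExtension K eps =
    IsExtension K eps ×
    (∀ (K' : Action B 0ℓ 0ℓ)
       (eps' : ∀ a → Setoid.Carrier (X'.S a) → Setoid.Carrier (Action.S K' (F₀ a))) →
       IsExtension K' eps' →
       Σ (NatTrans B K K') λ α →
         (∀ a (x : Setoid.Carrier (X'.S a)) →
            Setoid._≈_ (Action.S K' (F₀ a)) (eps' a x) (NatTrans.α α (F₀ a) (eps a x)))
         ×
         (∀ (β : NatTrans B K K') →
            (∀ a (x : Setoid.Carrier (X'.S a)) →
               Setoid._≈_ (Action.S K' (F₀ a)) (eps' a x) (NatTrans.α β (F₀ a) (eps a x))) →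
            ∀ b (z : Setoid.Carrier (Action.S K b)) →
              Setoid._≈_ (Action.S K' b) (NatTrans.α β b z) (NatTrans.α α b z)))

module Construction
  (Γ Δ : Graph)
  (RelB : ∀ {B B'} → Rel (Path Δ B B') 0ℓ)
  (X : V Γ → Set)
  (Xa : ∀ {A₁ A₂} → E Γ A₁ A₂ → X A₁ → X A₂)
  (F₀ : V Γ → V Δ)
  (Fe : ∀ {A₁ A₂} → E Γ A₁ A₂ → Path Δ (F₀ A₁) (F₀ A₂))
  where

  -- T = ⊔_B ⊔_A X A × P(F A , B); the element (B , A , x , p) is x|p.
  T : Set
  T = Σ (V Δ) λ B → Σ (V Γ) λ A → X A × Path Δ (F₀ A) B

  τ : T → V Δ
  τ = proj₁

  _·_ : (t : T) → ∀ {B'} → Path Δ (τ t) B' → T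
  t · q = (_ , proj₁ (proj₂ t) , proj₁ (proj₂ (proj₂ t)) , proj₂ (proj₂ (proj₂ t)) ◅◅ q)

  data Rε : Rel T 0ℓ where
    rε : ∀ {A₁ A₂} (a : E Γ A₁ A₂) (x : X A₁) →
         Rε (F₀ A₂ , A₁ , x , Fe a) (F₀ A₂ , A₂ , Xa a x , ε)

  data _⟶_ : Rel T 0ℓ where
    red-T : ∀ {s u : T} → Rε s u → (e : τ s ≡ τ u) → ∀ {B'} (q : Path Δ (τ u) B') →
            (s · ≡.subst (λ b → Path Δ b B') (≡.sym e) q) ⟶ (u · q)
    red-P : ∀ (s : T) {B' B''} {l r : Path Δ (τ s) B'} → RelB l r →
            (q : Path Δ B' B'') → (s · (l ◅◅ q)) ⟶ (s · (r ◅◅ q))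

  _↔*_ : Rel T 0ℓ
  _↔*_ = EqClosure _⟶_

  KS : V Δ → Setoid 0ℓ 0ℓ
  KS B = record
    { Carrier = Σ T (λ t → τ t ≡ B)
    ; _≈_ = λ t t' → proj₁ t ↔* proj₁ t'
    ; isEquivalence = record
        { refl = IsEquivalence.refl (eqc-isEquivalence _⟶_)
        ; sym = IsEquivalence.sym (eqc-isEquivalence _⟶_)
        ; trans = IsEquivalence.trans (eqc-isEquivalence _⟶_)
        }
    }

  Kact : ∀ {B₁ B₂} → Setoid.Carrier (KS B₁) → Path Δ B₁ B₂ → Setoid.Carrier (KS B₂)
  Kact (t , e) p = (t · ≡.subst (λ b → Path Δ b _) (≡.sym e) p) , ≡.refl

  εK : ∀ A → X A → Setoid.Carrier (KS (F₀ A))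
  εK A x = (F₀ A , A , x , ε) , ≡.refl

-- Reductions never change τ, so ↔* splits into fibres over the objects of Δ.
-- Right multiplication by a path commutes with both kinds of reduction, and a
-- RelB-rewrite inside a path is itself an R_K-reduction; hence [t]·[p] := [t·p]
-- is a well-defined action of 𝐁.  For naturality of ε, write an arrow of 𝐀 as
-- a composite w of generators: R_ε reduces x|F(w) to (x·w)|id letter by letter.
-- For universality, any extension (K', ε') forces α[x|p] = ε'(x)·p; this
-- respects R_ε because ε' is natural and R_K because K' is a 𝐁-action.
module Submission where

open import Defs
open import Level using (Level; 0ℓ)
open import Function.Base using (id; _on_)
open import Data.Product using (Σ; _×_; _,_; proj₁)
open import Relation.Binary using (Rel; Setoid; _=[_]⇒_)
open import Relation.Binary.PropositionalEquality as ≡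
  using (_≡_; setoid; refl; sym; trans; cong; subst; subst₂)
open import Axiom.UniquenessOfIdentityProofs.WithK using (uip)
open import Relation.Binary.Construct.Closure.ReflexiveTransitive
  using (ε; _◅_; _◅◅_)
open import Relation.Binary.Construct.Closure.ReflexiveTransitive.Properties
  using (◅◅-assoc)
open import Relation.Binary.Construct.Closure.Symmetric using (fwd; bwd)
open import Relation.Binary.Construct.Closure.Equivalence as EqC using (EqClosure)
import Relation.Binary.Reasoning.Setoid as SetoidReasoning

module _ {a b ℓ : Level} {T : Set a} {O : Set b} (τ : T → O)
         {_⟶_ : Rel T ℓ} (⟶-τ : _⟶_ =[ τ ]⇒ _≡_) where

  EqClosure-fibre : ∀ {o t t'} (e : τ t ≡ o) (e' : τ t' ≡ o) →
    EqClosure _⟶_ t t' → EqClosure (_⟶_ on proj₁) (t , e) (t' , e')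
  EqClosure-fibre e e' ε rewrite uip e e' = ε
  EqClosure-fibre e e' (fwd r ◅ rs) =
    fwd r ◅ EqClosure-fibre (trans (sym (⟶-τ r)) e) e' rs
  EqClosure-fibre e e' (bwd r ◅ rs) =
    bwd r ◅ EqClosure-fibre (trans (⟶-τ r) e) e' rs

module TermAction
    (Γ Δ : Graph)
    (RelB : ∀ {B B'} → Rel (Path Δ B B') 0ℓ)
    (X : V Γ → Set)
    (Xa : ∀ {A₁ A₂} → E Γ A₁ A₂ → X A₁ → X A₂)
    (F₀ : V Γ → V Δ)
    (Fe : ∀ {A₁ A₂} → E Γ A₁ A₂ → Path Δ (F₀ A₁) (F₀ A₂)) where

  open Construction Γ Δ RelB X Xa F₀ Fe public

  𝐁 : Category (V Δ)
  𝐁 = QuotCat Δ RelB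

  open Category 𝐁 using (_≈_)
  module ↔* = Setoid (EqC.setoid _⟶_)
  open SetoidReasoning (EqC.setoid _⟶_)

  Fibre : V Δ → Set
  Fibre B = Σ T λ t → τ t ≡ B

  ⟶-τ : _⟶_ =[ τ ]⇒ _≡_
  ⟶-τ (red-T _ _ _) = refl
  ⟶-τ (red-P _ _ _) = refl

  ↔*-τ : _↔*_ =[ τ ]⇒ _≡_
  ↔*-τ = EqC.gfold ≡.isEquivalence τ ⟶-τ

  -- x|p is definitionally ι A x · p, since ε ◅◅ p reduces to p.
  ι : ∀ A → X A → T
  ι A x = F₀ A , A , x , ε

  ·-identityʳ : (t : T) → t · ε ≡ t
  ·-identityʳ (_ , A , x , p) = cong (ι A x ·_) (◅◅-rightId p)

  ·-assoc : (t : T) {B B' : V Δ} (p : Path Δ (τ t) B) (q : Path Δ B B') →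
            (t · p) · q ≡ t · (p ◅◅ q)
  ·-assoc (_ , A , x , p₀) p q = cong (ι A x ·_) (◅◅-assoc p₀ p q)

  Kact-step : ∀ {B C} {z z' : Fibre B} (q : Path Δ B C) →
              proj₁ z ⟶ proj₁ z' → proj₁ (Kact z q) ⟶ proj₁ (Kact z' q)
  Kact-step {z = _ , refl} {_ , refl} q (red-T (rε {A₁} a x) refl q₀) =
    subst (_⟶ (ι _ (Xa a x) · (q₀ ◅◅ q))) (sym (·-assoc (ι A₁ x · Fe a) q₀ q))
      (red-T (rε a x) refl (q₀ ◅◅ q))
  Kact-step {z = _ , refl} {_ , refl} q (red-P s {l = l} {r} rel q₀) =
    subst₂ _⟶_ (reassoc l) (reassoc r) (red-P s rel (q₀ ◅◅ q))
    where
    reassoc : (k : Path Δ (τ s) _) → s · (k ◅◅ q₀ ◅◅ q) ≡ (s · (k ◅◅ q₀)) · q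
    reassoc k = sym (trans (·-assoc s (k ◅◅ q₀) q) (cong (s ·_) (◅◅-assoc k q₀ q)))

  Kact-congˡ : ∀ {B C} {z z' : Fibre B} (q : Path Δ B C) →
               proj₁ z ↔* proj₁ z' → proj₁ (Kact z q) ↔* proj₁ (Kact z' q)
  Kact-congˡ {z = _ , e} {_ , e'} q h =
    EqC.gmap proj₁ id
      (EqC.gmap (λ z → Kact z q) (Kact-step q) (EqClosure-fibre τ ⟶-τ e e' h))

  ·-congʳ : ∀ (t : T) {C} {f g : Path Δ (τ t) C} → f ≈ g → (t · f) ↔* (t · g)
  ·-congʳ t (∼-base {l = l} {r} rel) =
    subst₂ _↔*_ (cong (t ·_) (◅◅-rightId l)) (cong (t ·_) (◅◅-rightId r))
      (EqC.return (red-P t rel ε))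
  ·-congʳ t ∼-refl = ε
  ·-congʳ t (∼-sym h) = ↔*.sym (·-congʳ t h)
  ·-congʳ t (∼-trans h h') = ·-congʳ t h ◅◅ ·-congʳ t h'
  ·-congʳ t (∼-comp {p = p} {p'} {q} {q'} hp hq) = begin
    t · (p ◅◅ q)    ≡⟨ ·-assoc t p q ⟨
    (t · p) · q     ≈⟨ Kact-congˡ {z = t · p , refl} {t · p' , refl} q (·-congʳ t hp) ⟩
    (t · p') · q    ≈⟨ ·-congʳ (t · p') hq ⟩
    (t · p') · q'   ≡⟨ ·-assoc t p' q' ⟩
    t · (p' ◅◅ q')  ∎

  Kact-cong : ∀ {B C} {z z' : Fibre B} {f g : Path Δ B C} →
              proj₁ z ↔* proj₁ z' → f ≈ g → proj₁ (Kact z f) ↔* proj₁ (Kact z' g)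
  Kact-cong {z' = t' , refl} {f} h fg = Kact-congˡ f h ◅◅ ·-congʳ t' fg

  K-isAction : IsAction 𝐁 KS Kact
  K-isAction = record
    { act-cong = Kact-cong
    ; act-id   = λ { (t , refl) → ↔*.reflexive (·-identityʳ t) }
    ; act-comp = λ { (t , refl) f g → ↔*.reflexive (·-assoc t f g) }
    }

  F-path : ∀ {A₁ A₂} → Path Γ A₁ A₂ → Path Δ (F₀ A₁) (F₀ A₂)
  F-path ε = ε
  F-path (a ◅ w) = Fe a ◅◅ F-path w

  X-path : ∀ {A₁ A₂} → Path Γ A₁ A₂ → X A₁ → X A₂
  X-path ε x = x
  X-path (a ◅ w) x = X-path w (Xa a x)

  ι·F-path↔*ι : ∀ {A₁ A₂} (w : Path Γ A₁ A₂) (x : X A₁) →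
                (ι A₁ x · F-path w) ↔* ι A₂ (X-path w x)
  ι·F-path↔*ι ε x = ε
  ι·F-path↔*ι (a ◅ w) x =
    EqC.return (red-T (rε a x) refl (F-path w)) ◅◅ ι·F-path↔*ι w (Xa a x)

module KanExtension
    (Γ Δ : Graph)
    (RelB : ∀ {B B'} → Rel (Path Δ B B') 0ℓ)
    (X : V Γ → Set)
    (Xa : ∀ {A₁ A₂} → E Γ A₁ A₂ → X A₁ → X A₂)
    (F₀ : V Γ → V Δ)
    (Fe : ∀ {A₁ A₂} → E Γ A₁ A₂ → Path Δ (F₀ A₁) (F₀ A₂))
    (𝐀 : Category (V Γ))
    (gen : ∀ {A₁ A₂} → E Γ A₁ A₂ → Category.Hom 𝐀 A₁ A₂)
    (gen-generates : GeneratedBy 𝐀 gen)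
    (X'act : ∀ {A₁ A₂} → X A₁ → Category.Hom 𝐀 A₁ A₂ → X A₂)
    (X'isAction : IsAction 𝐀 (λ A → setoid (X A)) X'act)
    (X'-on-Γ : ∀ {A₁ A₂} (a : E Γ A₁ A₂) (x : X A₁) → X'act x (gen a) ≡ Xa a x)
    (F' : Functor 𝐀 (QuotCat Δ RelB) F₀)
    (F'-on-Γ : ∀ {A₁ A₂} (a : E Γ A₁ A₂) → _∼_ Δ RelB (F₁ F' (gen a)) (Fe a)) where

  open TermAction Γ Δ RelB X Xa F₀ Fe public
  open Category 𝐁 using (_≈_)
  open IsAction X'isAction using ()
    renaming (act-cong to X'-cong; act-id to X'-id; act-comp to X'-comp)

  X' : Action 𝐀 0ℓ 0ℓ
  X' = mkAction 𝐀 (λ A → setoid (X A)) X'act X'isAction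

  K : Action 𝐁 0ℓ 0ℓ
  K = mkAction 𝐁 KS Kact K-isAction

  F₁-interp : ∀ {A₁ A₂} (w : Path Γ A₁ A₂) → F₁ F' (interp 𝐀 gen w) ≈ F-path w
  F₁-interp ε = Functor.F-id F'
  F₁-interp (a ◅ w) = ∼-trans (Functor.F-comp F' (gen a) (interp 𝐀 gen w))
                              (∼-comp (F'-on-Γ a) (F₁-interp w))

  X'act-interp : ∀ {A₁ A₂} (w : Path Γ A₁ A₂) (x : X A₁) →
                 X'act x (interp 𝐀 gen w) ≡ X-path w x
  X'act-interp ε x = X'-id x
  X'act-interp (a ◅ w) x = begin
    X'act x (gen a ⨾ w̄)           ≡⟨ X'-comp x (gen a) w̄ ⟨
    X'act (X'act x (gen a)) w̄     ≡⟨ cong (λ y → X'act y w̄) (X'-on-Γ a x) ⟩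
    X'act (Xa a x) w̄              ≡⟨ X'act-interp w (Xa a x) ⟩
    X-path w (Xa a x)             ∎
    where
    open ≡.≡-Reasoning
    open Category 𝐀 using (_⨾_)
    w̄ = interp 𝐀 gen w

  εK-natural : ∀ {A₁ A₂} (f : Category.Hom 𝐀 A₁ A₂) (x : X A₁) →
               ι A₂ (X'act x f) ↔* (ι A₁ x · F₁ F' f)
  εK-natural {A₁} {A₂} f x with gen-generates f
  ... | w , f≈w = begin
    ι A₂ (X'act x f)    ≡⟨ cong (ι A₂) (trans (X'-cong refl f≈w) (X'act-interp w x)) ⟩
    ι A₂ (X-path w x)   ≈⟨ ι·F-path↔*ι w x ⟨
    ι A₁ x · F-path w   ≈⟨ ·-congʳ (ι A₁ x) F₁f≈F-path-w ⟨
    ι A₁ x · F₁ F' f    ∎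
    where
    open SetoidReasoning (EqC.setoid _⟶_)
    F₁f≈F-path-w : F₁ F' f ≈ F-path w
    F₁f≈F-path-w = ∼-trans (Functor.F-cong F' f≈w) (F₁-interp w)

  εK-isExtension : IsExtension X' F' K εK
  εK-isExtension = record
    { eps-cong = λ { refl → ε }
    ; eps-nat = εK-natural
    }

  module Universal (K' : Action 𝐁 0ℓ 0ℓ)
      (eps' : ∀ A → X A → Setoid.Carrier (Action.S K' (F₀ A)))
      (eps'-isExtension : IsExtension X' F' K' eps') where
    open Action K' using () renaming (act to _·'_)
    open IsAction (Action.isAction K')
    open IsExtension eps'-isExtension
    module K' (B : V Δ) = Setoid (Action.S K' B)

    eps'-on-Γ : ∀ {A₁ A₂} (a : E Γ A₁ A₂) (x : X A₁) →
                K'._≈_ (F₀ A₂) (eps' A₂ (Xa a x)) (eps' A₁ x ·' Fe a)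
    eps'-on-Γ {A₁} {A₂} a x = begin
      eps' A₂ (Xa a x)               ≈⟨ eps-cong (X'-on-Γ a x) ⟨
      eps' A₂ (X'act x (gen a))      ≈⟨ eps-nat (gen a) x ⟩
      eps' A₁ x ·' F₁ F' (gen a)     ≈⟨ act-cong (K'.refl (F₀ A₁)) (F'-on-Γ a) ⟩
      eps' A₁ x ·' Fe a              ∎
      where open SetoidReasoning (Action.S K' (F₀ A₂))

    mediate : ∀ B → Fibre B → Setoid.Carrier (Action.S K' B)
    mediate B ((_ , A , x , p) , refl) = eps' A x ·' p

    mediate-respects-⟶ : ∀ {B} {z z' : Fibre B} →
                         proj₁ z ⟶ proj₁ z' → K'._≈_ B (mediate B z) (mediate B z')
    mediate-respects-⟶ {B} {_ , refl} {_ , refl} (red-T (rε {A₁} {A₂} a x) refl q) = begin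
      eps' A₁ x ·' (Fe a ◅◅ q)      ≈⟨ act-comp (eps' A₁ x) (Fe a) q ⟨
      (eps' A₁ x ·' Fe a) ·' q      ≈⟨ act-cong (eps'-on-Γ a x) ∼-refl ⟨
      eps' A₂ (Xa a x) ·' q         ∎
      where open SetoidReasoning (Action.S K' B)
    mediate-respects-⟶ {z = _ , refl} {_ , refl} (red-P (_ , A , x , p) rel q) =
      act-cong (K'.refl (F₀ A)) (∼-comp (∼-refl {p = p}) (∼-comp (∼-base rel) ∼-refl))

    mediator : NatTrans 𝐁 K K'
    mediator = record
      { α = mediate
      ; α-cong = λ { {B} {t , e} {t' , e'} h →
          EqC.gfold (K'.isEquivalence B) (mediate B)
            (λ {z} {z'} → mediate-respects-⟶ {z = z} {z'}) (EqClosure-fibre τ ⟶-τ e e' h) }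
      ; α-nat = λ { ((_ , A , x , p) , refl) f → K'.sym _ (act-comp (eps' A x) p f) }
      }

    mediate-εK : ∀ A (x : X A) → K'._≈_ (F₀ A) (eps' A x) (mediate (F₀ A) (εK A x))
    mediate-εK A x = K'.sym (F₀ A) (act-id (eps' A x))

    mediator-unique : ∀ (β : NatTrans 𝐁 K K') →
      (∀ A (x : X A) → K'._≈_ (F₀ A) (eps' A x) (NatTrans.α β (F₀ A) (εK A x))) →
      ∀ B (z : Fibre B) → K'._≈_ B (NatTrans.α β B z) (mediate B z)
    mediator-unique β eps'≈β∘εK B ((_ , A , x , p) , refl) =
      K'.trans B (α-nat β (εK A x) p) (act-cong (K'.sym (F₀ A) (eps'≈β∘εK A x)) ∼-refl)

  K-isKanExtension : IsKanExtension X' F' K εK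
  K-isKanExtension = εK-isExtension , λ K' eps' eps'-isExtension →
    let open Universal K' eps' eps'-isExtension in mediator , mediate-εK , mediator-unique

mainTheorem1 :
    (Γ Δ : Graph)
    (RelB : ∀ {B B'} → Rel (Path Δ B B') 0ℓ)
    (X : V Γ → Set)
    (Xa : ∀ {A₁ A₂} → E Γ A₁ A₂ → X A₁ → X A₂)
    (F₀ : V Γ → V Δ)
    (Fe : ∀ {A₁ A₂} → E Γ A₁ A₂ → Path Δ (F₀ A₁) (F₀ A₂))
    (𝐀 : Category (V Γ))
    (gen : ∀ {A₁ A₂} → E Γ A₁ A₂ → Category.Hom 𝐀 A₁ A₂)
    (gen-generates : GeneratedBy 𝐀 gen)
    (X'act : ∀ {A₁ A₂} → X A₁ → Category.Hom 𝐀 A₁ A₂ → X A₂)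
    (X'isAction : IsAction 𝐀 (λ A → setoid (X A)) X'act)
    (X'-on-Γ : ∀ {A₁ A₂} (a : E Γ A₁ A₂) (x : X A₁) → X'act x (gen a) ≡ Xa a x)
    (F' : Functor 𝐀 (QuotCat Δ RelB) F₀)
    (F'-on-Γ : ∀ {A₁ A₂} (a : E Γ A₁ A₂) → _∼_ Δ RelB (F₁ F' (gen a)) (Fe a)) →
    let open Construction Γ Δ RelB X Xa F₀ Fe in
    -- (i)
    (∀ (t₁ t₂ : T) → t₁ ↔* t₂ → τ t₁ ≡ τ t₂)
    ×
    -- (ii) K is (well defined and) an action of 𝐁, and (iii) (K , ε) is a Kan extension
    Σ (IsAction (QuotCat Δ RelB) KS Kact) (λ K-isAction →
      IsKanExtension (mkAction 𝐀 (λ A → setoid (X A)) X'act X'isAction) F'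
        (mkAction (QuotCat Δ RelB) KS Kact K-isAction) εK)
mainTheorem1 Γ Δ RelB X Xa F₀ Fe 𝐀 gen gen-generates X'act X'isAction X'-on-Γ F' F'-on-Γ =
  (λ _ _ → ↔*-τ) , K-isAction , K-isKanExtension
  where open KanExtension Γ Δ RelB X Xa F₀ Fe 𝐀 gen gen-generates
                          X'act X'isAction X'-on-Γ F' F'-on-Γ
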